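{- Let $A=\begin{pmatrix} a & b \\ c & 0 \end{pmatrix}\in M_2(\mathbb{Z})$ with $bc\neq 0$ and $\gcd(a,b,c)=1$, let $K=\mathbb{Q}(\sqrt{a^2+4bc})$ with ring of integers $\mathcal{O}_K$, and let $n\geq 3$ be an integer. Then there exist $X,Y,Z\in C(A)$ with $\det(XYZ)\neq 0$ and $X^n+Y^n=Z^n$ if and only if there exist $x,y,z\in\mathcal{O}_K$ with $xyz\neq 0$ and $x^n+y^n=z^n$.
   Context: $C(A)=\{B\in M_2(\mathbb{Z}): AB=BA\}$. If $a^2+4bc$ is a square, $K=\mathbb{Q}$ and $\mathcal{O}_K=\mathbb{Z}$. -}

module Defs where

open import Data.Nat as ℕ using (ℕ; zero; suc)
open import Data.Fin using (Fin; toℕ) renaming (zero to fzero; suc to fsuc)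
open import Data.Integer as ℤ using (ℤ; +_)
open import Data.Rational as ℚ using (ℚ; 0ℚ; 1ℚ)
open import Data.Product using (Σ; ∃; ∃-syntax; _×_; _,_)
open import Relation.Binary.PropositionalEquality using (_≡_; _≢_)

record M2 : Set where
  constructor mat
  field
    m11 m12 m21 m22 : ℤ
open M2 public

_·_ : M2 → M2 → M2
X · Y = mat (m11 X ℤ.* m11 Y ℤ.+ m12 X ℤ.* m21 Y)
            (m11 X ℤ.* m12 Y ℤ.+ m12 X ℤ.* m22 Y)
            (m21 X ℤ.* m11 Y ℤ.+ m22 X ℤ.* m21 Y)
            (m21 X ℤ.* m12 Y ℤ.+ m22 X ℤ.* m22 Y)

_⊞_ : M2 → M2 → M2
X ⊞ Y = mat (m11 X ℤ.+ m11 Y) (m12 X ℤ.+ m12 Y) (m21 X ℤ.+ m21 Y) (m22 X ℤ.+ m22 Y)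

I₂ : M2
I₂ = mat (+ 1) (+ 0) (+ 0) (+ 1)

_^ᴹ_ : M2 → ℕ → M2
X ^ᴹ zero  = I₂
X ^ᴹ suc n = X · (X ^ᴹ n)

det : M2 → ℤ
det X = m11 X ℤ.* m22 X ℤ.- m12 X ℤ.* m21 X

_∈C_ : M2 → M2 → Set
B ∈C A = A · B ≡ B · A

IsSquare : ℤ → Set
IsSquare d = ∃[ r ] r ℤ.* r ≡ d

-- The quadratic field K = ℚ(√d) (for d not a square), elements p + q√d

record QF : Set where
  constructor _+√_
  field
    re im : ℚ
open QF public

module _ (d : ℤ) where
  dℚ : ℚ
  dℚ = d ℚ./ 1

  addK : QF → QF → QF
  addK x y = (re x ℚ.+ re y) +√ (im x ℚ.+ im y)

  mulK : QF → QF → QF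
  mulK x y = (re x ℚ.* re y ℚ.+ dℚ ℚ.* (im x ℚ.* im y))
           +√ (re x ℚ.* im y ℚ.+ im x ℚ.* re y)

  powK : QF → ℕ → QF
  powK x zero    = 1ℚ +√ 0ℚ
  powK x (suc n) = mulK x (powK x n)

  sumK : (k : ℕ) → (Fin k → QF) → QF
  sumK zero    f = 0ℚ +√ 0ℚ
  sumK (suc k) f = addK (f fzero) (sumK k (λ i → f (fsuc i)))

  IsAlgInt : QF → Set
  IsAlgInt x = Σ ℕ λ k → Σ (Fin k → ℤ) λ c → addK (powK x k)
                 (sumK k (λ i → mulK ((c i ℚ./ 1) +√ 0ℚ) (powK x (toℕ i))))
               ≡ (0ℚ +√ 0ℚ)

0K : QF
0K = 0ℚ +√ 0ℚ

FermatC : M2 → ℕ → Set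
FermatC A n = ∃[ X ] ∃[ Y ] ∃[ Z ]
  (X ∈C A) × (Y ∈C A) × (Z ∈C A) × (det (X · (Y · Z)) ≢ + 0)
  × ((X ^ᴹ n) ⊞ (Y ^ᴹ n) ≡ Z ^ᴹ n)

-- ∃ x, y, z ∈ ℤ with xyz ≠ 0 and xⁿ + yⁿ = zⁿ   (O_K = ℤ when K = ℚ)
Fermatℤ : ℕ → Set
Fermatℤ n = ∃[ x ] ∃[ y ] ∃[ z ] (x ℤ.* y ℤ.* z ≢ + 0)
  × (x ℤ.^ n ℤ.+ y ℤ.^ n ≡ z ℤ.^ n)

FermatOK : ℤ → ℕ → Set
FermatOK d n = ∃[ x ] ∃[ y ] ∃[ z ]
  IsAlgInt d x × IsAlgInt d y × IsAlgInt d z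
  × (mulK d x (mulK d y z) ≢ 0K)
  × (addK d (powK d x n) (powK d y n) ≡ powK d z n)

-- A matrix X commuting with A = [[a, b], [c, 0]] is αI + βA: its (1,2)-entry q satisfies
-- b ∣ aq, b ∣ bq and b ∣ cq, so gcd(a, b, c) = 1 gives b ∣ q. Since A² = aA + bcI, C(A) is
-- the ring ℤ[θ] with θ² = aθ + bc, and det is its norm. If d = a² + 4bc = r², then
-- τ = (a + r)/2 is an integer root, θ ↦ τ is a ring map to ℤ whose value divides the norm,
-- and integer solutions come back as scalar matrices. Otherwise θ ↦ (a + √d)/2 embeds ℤ[θ]
-- into O_K, an element has nonzero norm iff it is nonzero, and as the Fermat equation is
-- homogeneous, a solution in K is moved into the image by clearing denominators.

module Submission where

open import Defs
open import Data.Nat using (ℕ; _≥_)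
open import Data.Integer using (ℤ; +_; _+_; _*_)
open import Data.Integer.GCD using (gcd)
open import Data.Product using (_×_)
open import Relation.Nullary using (¬_)
open import Relation.Binary.PropositionalEquality using (_≡_; _≢_)
open import Function.Bundles using (_⇔_)

import Data.Nat as ℕ
import Data.Nat.Properties as ℕ
import Data.Nat.Divisibility as ℕ
import Data.Nat.DivMod as ℕ
import Data.Nat.GCD as ℕ
import Data.Nat.Coprimality as ℕ using (Coprime; coprime-/gcd; coprime-divisor; sym)
open import Data.Nat.Primality using (euclidsLemma; prime[2])
open import Data.Nat.Tactic.RingSolver using () renaming (solve-∀ to solve-∀ℕ)
open import Data.Integer using (_-_; -_; _^_; 0ℤ; 1ℤ; ∣_∣; +0; +[1+_]; -[1+_]; ≢-nonZero)
open import Data.Integer.Properties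
  using (abs-*; pos-*; ∣i∣≡0⇒i≡0; +-injective; *-comm; *-identityʳ; *-distribʳ-+;
         *-zeroˡ; *-zeroʳ; *-cancelˡ-≡; *-cancelʳ-≡; i*j≡0⇒i≡0∨j≡0)
open import Data.Integer.Divisibility.Signed using (_∣_; divides; ∣ᵤ⇒∣; ∣⇒∣ᵤ)
open import Data.Integer.Tactic.RingSolver using (solve; solve-∀)
open import Data.Rational as ℚ using (ℚ; mkℚ; 0ℚ; 1ℚ; ½; ↧_)
import Data.Rational.Properties as ℚ
open import Data.Rational.Unnormalised as ℚᵘ using (mkℚᵘ; *≡*)
import Data.Rational.Unnormalised.Properties as ℚᵘ
import Tactic.RingSolver as Ring
import Tactic.RingSolver.Core.AlmostCommutativeRing as ACR
open import Data.Fin using (Fin) renaming (zero to fzero; suc to fsuc)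
open import Data.List using (_∷_; [])
open import Data.Product using (∃-syntax; _,_; proj₁; proj₂)
open import Data.Sum using ([_,_]′; inj₂)
open import Data.Empty using (⊥-elim)
open import Function.Base using (id)
open import Function.Bundles using (mk⇔)
import Function.Properties.Equivalence as ⇔
open import Level using (0ℓ)
open import Relation.Nullary using (contradiction)
open import Relation.Nullary.Decidable using (dec⇒maybe)
open import Relation.Binary.PropositionalEquality
  using (refl; sym; trans; cong; cong₂; subst; module ≡-Reasoning)

mat-cong : ∀ {w x y z w′ x′ y′ z′} → w ≡ w′ → x ≡ x′ → y ≡ y′ → z ≡ z′ →
           mat w x y z ≡ mat w′ x′ y′ z′
mat-cong refl refl refl refl = refl

det-· : ∀ X Y → det (X · Y) ≡ det X * det Y
det-· (mat p q r s) (mat p′ q′ r′ s′) = identity p q r s p′ q′ r′ s′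
  where
  identity : ∀ p q r s p′ q′ r′ s′ →
    (p * p′ + q * r′) * (r * q′ + s * s′) - (p * q′ + q * s′) * (r * p′ + s * r′)
      ≡ (p * s - q * r) * (p′ * s′ - q′ * r′)
  identity = solve-∀

det-·³ : ∀ X Y Z → det (X · (Y · Z)) ≡ det X * (det Y * det Z)
det-·³ X Y Z = trans (det-· X (Y · Z)) (cong (det X *_) (det-· Y Z))

*-≢0 : ∀ {i j} → i ≢ 0ℤ → j ≢ 0ℤ → i * j ≢ 0ℤ
*-≢0 {i} i≢0 j≢0 ij≡0 = [ i≢0 , j≢0 ]′ (i*j≡0⇒i≡0∨j≡0 i ij≡0)

*≢0⇒≢0ˡ : ∀ {i} j → i * j ≢ 0ℤ → i ≢ 0ℤ
*≢0⇒≢0ˡ j ij≢0 refl = ij≢0 (*-zeroˡ j)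

*≢0⇒≢0ʳ : ∀ i {j} → i * j ≢ 0ℤ → j ≢ 0ℤ
*≢0⇒≢0ʳ i ij≢0 refl = ij≢0 (*-zeroʳ i)

∣gcd[m,n]*x : ∀ {k} m n x → k ℕ.∣ m ℕ.* x → k ℕ.∣ n ℕ.* x → k ℕ.∣ ℕ.gcd m n ℕ.* x
∣gcd[m,n]*x {k} m n x k∣mx k∣nx =
  subst (k ℕ.∣_) (trans (sym (ℕ.c*gcd[m,n]≡gcd[cm,cn] x m n)) (ℕ.*-comm x (ℕ.gcd m n)))
    (ℕ.gcd-greatest (subst (k ℕ.∣_) (ℕ.*-comm m x) k∣mx) (subst (k ℕ.∣_) (ℕ.*-comm n x) k∣nx))

gcd≡1∧∣*⇒∣ : ∀ {k q} a b c → gcd (gcd a b) c ≡ + 1 →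
             k ∣ a * q → k ∣ b * q → k ∣ c * q → k ∣ q
gcd≡1∧∣*⇒∣ {k} {q} a b c gcd≡1 k∣aq k∣bq k∣cq = ∣ᵤ⇒∣ (subst (∣ k ∣ ℕ.∣_) (ℕ.*-identityˡ ∣ q ∣) k∣1q)
  where
  ∣* : ∀ i → k ∣ i * q → ∣ k ∣ ℕ.∣ ∣ i ∣ ℕ.* ∣ q ∣
  ∣* i k∣iq = subst (∣ k ∣ ℕ.∣_) (abs-* i q) (∣⇒∣ᵤ k∣iq)
  k∣1q : ∣ k ∣ ℕ.∣ 1 ℕ.* ∣ q ∣
  k∣1q = subst (λ g → ∣ k ∣ ℕ.∣ g ℕ.* ∣ q ∣) (+-injective gcd≡1)
           (∣gcd[m,n]*x (ℕ.gcd (∣ a ∣) (∣ b ∣)) (∣ c ∣) (∣ q ∣)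
             (∣gcd[m,n]*x (∣ a ∣) (∣ b ∣) (∣ q ∣) (∣* a k∣aq) (∣* b k∣bq)) (∣* c k∣cq))

2∣i*i⇒2∣i : ∀ i → + 2 ∣ i * i → + 2 ∣ i
2∣i*i⇒2∣i i 2∣i*i =
  ∣ᵤ⇒∣ ([ id , id ]′ (euclidsLemma ∣ i ∣ ∣ i ∣ prime[2] (subst (2 ℕ.∣_) (abs-* i i) (∣⇒∣ᵤ 2∣i*i))))

-- The root (a + r) / 2 is integral because (a + r)² = 2 (a (a + r) + 2 b c) is even.
square-discriminant⇒root : ∀ a b c r → r * r ≡ a * a + + 4 * b * c → ∃[ τ ] τ * τ ≡ a * τ + b * c
square-discriminant⇒root a b c r r²≡disc =
  root (2∣i*i⇒2∣i (a + r) (divides (a * (a + r) + + 2 * b * c) [a+r]²≡2k))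
  where
  open ≡-Reasoning
  [a+r]²≡2k : (a + r) * (a + r) ≡ (a * (a + r) + + 2 * b * c) * + 2
  [a+r]²≡2k = begin
    (a + r) * (a + r)                          ≡⟨ solve (a ∷ r ∷ []) ⟩
    a * a + + 2 * a * r + r * r                ≡⟨ cong (λ u → a * a + + 2 * a * r + u) r²≡disc ⟩
    a * a + + 2 * a * r + (a * a + + 4 * b * c) ≡⟨ solve (a ∷ b ∷ c ∷ r ∷ []) ⟩
    (a * (a + r) + + 2 * b * c) * + 2          ∎
  root : + 2 ∣ a + r → ∃[ τ ] τ * τ ≡ a * τ + b * c
  root (divides τ a+r≡2τ) = τ , *-cancelˡ-≡ (+ 4) (τ * τ) (a * τ + b * c) (begin
    + 4 * (τ * τ)                              ≡⟨ solve (τ ∷ []) ⟩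
    τ * + 2 * (τ * + 2)                        ≡⟨ cong (λ u → u * u) (sym a+r≡2τ) ⟩
    (a + r) * (a + r)                          ≡⟨ [a+r]²≡2k ⟩
    (a * (a + r) + + 2 * b * c) * + 2          ≡⟨ cong (λ u → (a * u + + 2 * b * c) * + 2) a+r≡2τ ⟩
    (a * (τ * + 2) + + 2 * b * c) * + 2        ≡⟨ solve (a ∷ b ∷ c ∷ τ ∷ []) ⟩
    + 4 * (a * τ + b * c)                      ∎)

m²≡Dn²⇒square : ∀ m n D → n ≢ 0 → m ℕ.* m ≡ D ℕ.* (n ℕ.* n) → ∃[ r ] r ℕ.* r ≡ D
m²≡Dn²⇒square m n D n≢0 m²≡Dn² = m′ , (begin
  m′ ℕ.* m′          ≡⟨ m′²≡Dn′² ⟩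
  D ℕ.* (n′ ℕ.* n′)  ≡⟨ cong (λ k → D ℕ.* (k ℕ.* k)) n′≡1 ⟩
  D ℕ.* 1            ≡⟨ ℕ.*-identityʳ D ⟩
  D                  ∎)
  where
  open ≡-Reasoning
  g = ℕ.gcd m n
  instance _ = ℕ.≢-nonZero (ℕ.gcd[m,n]≢0 m n (inj₂ n≢0))
  m′ = m ℕ./ g
  n′ = n ℕ./ g
  regroup : ∀ x y → x ℕ.* y ℕ.* (x ℕ.* y) ≡ x ℕ.* x ℕ.* (y ℕ.* y)
  regroup = solve-∀ℕ
  m′²≡Dn′² : m′ ℕ.* m′ ≡ D ℕ.* (n′ ℕ.* n′)
  m′²≡Dn′² = ℕ.*-cancelʳ-≡ (m′ ℕ.* m′) (D ℕ.* (n′ ℕ.* n′)) (g ℕ.* g) {{ℕ.m*n≢0 g g}} (begin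
    m′ ℕ.* m′ ℕ.* (g ℕ.* g)        ≡⟨ sym (regroup m′ g) ⟩
    m′ ℕ.* g ℕ.* (m′ ℕ.* g)        ≡⟨ cong (λ k → k ℕ.* k) (ℕ.m/n*n≡m (ℕ.gcd[m,n]∣m m n)) ⟩
    m ℕ.* m                        ≡⟨ m²≡Dn² ⟩
    D ℕ.* (n ℕ.* n)                ≡⟨ cong (λ k → D ℕ.* (k ℕ.* k)) (sym (ℕ.m/n*n≡m (ℕ.gcd[m,n]∣n m n))) ⟩
    D ℕ.* (n′ ℕ.* g ℕ.* (n′ ℕ.* g)) ≡⟨ cong (D ℕ.*_) (regroup n′ g) ⟩
    D ℕ.* (n′ ℕ.* n′ ℕ.* (g ℕ.* g)) ≡⟨ sym (ℕ.*-assoc D (n′ ℕ.* n′) (g ℕ.* g)) ⟩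
    D ℕ.* (n′ ℕ.* n′) ℕ.* (g ℕ.* g) ∎)
  coprime : ℕ.Coprime m′ n′
  coprime = ℕ.coprime-/gcd m n
  n′∣m′ : n′ ℕ.∣ m′
  n′∣m′ = ℕ.coprime-divisor (ℕ.sym coprime)
            (ℕ.divides (D ℕ.* n′) (trans m′²≡Dn′² (sym (ℕ.*-assoc D n′ n′))))
  n′≡1 : n′ ≡ 1
  n′≡1 = coprime (n′∣m′ , ℕ.∣-refl)

i*i≡∣i∣² : ∀ i → i * i ≡ + (∣ i ∣ ℕ.* ∣ i ∣)
i*i≡∣i∣² (+ n)    = sym (pos-* n n)
i*i≡∣i∣² -[1+ n ] = refl

m²≡Dβ²⇒IsSquare : ∀ m β D → β ≢ 0ℤ → m * m ≡ D * (β * β) → IsSquare D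
m²≡Dβ²⇒IsSquare m β (+ k) β≢0 m²≡Dβ² =
  lift (m²≡Dn²⇒square ∣ m ∣ ∣ β ∣ k (λ ∣β∣≡0 → β≢0 (∣i∣≡0⇒i≡0 ∣β∣≡0)) ∣m∣²≡k∣β∣²)
  where
  ∣m∣²≡k∣β∣² : ∣ m ∣ ℕ.* ∣ m ∣ ≡ k ℕ.* (∣ β ∣ ℕ.* ∣ β ∣)
  ∣m∣²≡k∣β∣² = trans (sym (abs-* m m))
    (trans (cong ∣_∣ m²≡Dβ²) (trans (abs-* (+ k) (β * β)) (cong (k ℕ.*_) (abs-* β β))))
  lift : ∃[ r ] r ℕ.* r ≡ k → IsSquare (+ k)
  lift (r , r²≡k) = + r , trans (sym (pos-* r r)) (cong +_ r²≡k)
m²≡Dβ²⇒IsSquare m (+ 0)    -[1+ k ] β≢0 _ = ⊥-elim (β≢0 refl)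
m²≡Dβ²⇒IsSquare m +[1+ j ] -[1+ k ] _ m²≡Dβ² = contradiction (trans (sym (i*i≡∣i∣² m)) m²≡Dβ²) λ ()
m²≡Dβ²⇒IsSquare m -[1+ j ] -[1+ k ] _ m²≡Dβ² = contradiction (trans (sym (i*i≡∣i∣² m)) m²≡Dβ²) λ ()

ℚ-ring : ACR.AlmostCommutativeRing 0ℓ 0ℓ
ℚ-ring = ACR.fromCommutativeRing ℚ.+-*-commutativeRing (λ q → dec⇒maybe (0ℚ ℚ.≟ q))

ι : ℤ → ℚ
ι i = i ℚ./ 1

toℚᵘ-ι : ∀ i → ℚ.toℚᵘ (ι i) ℚᵘ.≃ mkℚᵘ i 0
toℚᵘ-ι i = ℚ.toℚᵘ-fromℚᵘ (mkℚᵘ i 0)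

ι-+ : ∀ i j → ι (i + j) ≡ ι i ℚ.+ ι j
ι-+ i j = ℚ.toℚᵘ-injective (ℚᵘ.≃-trans (toℚᵘ-ι (i + j)) (ℚᵘ.≃-trans (*≡* cross)
  (ℚᵘ.≃-sym (ℚᵘ.≃-trans (ℚ.toℚᵘ-homo-+ (ι i) (ι j)) (ℚᵘ.+-cong (toℚᵘ-ι i) (toℚᵘ-ι j))))))
  where
  cross : (i + j) * + 1 ≡ (i * + 1 + j * + 1) * + 1
  cross = solve (i ∷ j ∷ [])

ι-* : ∀ i j → ι (i * j) ≡ ι i ℚ.* ι j
ι-* i j = ℚ.toℚᵘ-injective (ℚᵘ.≃-trans (toℚᵘ-ι (i * j))
  (ℚᵘ.≃-sym (ℚᵘ.≃-trans (ℚ.toℚᵘ-homo-* (ι i) (ι j)) (ℚᵘ.*-cong (toℚᵘ-ι i) (toℚᵘ-ι j)))))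

ι-neg : ∀ i → ι (- i) ≡ ℚ.- ι i
ι-neg i = ℚ.toℚᵘ-injective (ℚᵘ.≃-trans (toℚᵘ-ι (- i))
  (ℚᵘ.≃-sym (ℚᵘ.≃-trans (ℚ.toℚᵘ-homo‿- (ι i)) (ℚᵘ.-‿cong (toℚᵘ-ι i)))))

ι-injective : ∀ {i j} → ι i ≡ ι j → i ≡ j
ι-injective {i} {j} eq
  with ℚᵘ.≃-trans (ℚᵘ.≃-sym (toℚᵘ-ι i)) (ℚᵘ.≃-trans (ℚ.toℚᵘ-cong eq) (toℚᵘ-ι j))
... | *≡* i*1≡j*1 = trans (sym (*-identityʳ i)) (trans i*1≡j*1 (*-identityʳ j))

infixl 6 _:+_
infixl 7 _:*_
infix  8 :-_

data Expr : Set where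
  con       : ℤ → Expr
  _:+_ _:*_ : Expr → Expr → Expr
  :-_       : Expr → Expr

⟦_⟧ℤ : Expr → ℤ
⟦ con i  ⟧ℤ = i
⟦ e :+ f ⟧ℤ = ⟦ e ⟧ℤ + ⟦ f ⟧ℤ
⟦ e :* f ⟧ℤ = ⟦ e ⟧ℤ * ⟦ f ⟧ℤ
⟦ :- e   ⟧ℤ = - ⟦ e ⟧ℤ

⟦_⟧ℚ : Expr → ℚ
⟦ con i  ⟧ℚ = ι i
⟦ e :+ f ⟧ℚ = ⟦ e ⟧ℚ ℚ.+ ⟦ f ⟧ℚ
⟦ e :* f ⟧ℚ = ⟦ e ⟧ℚ ℚ.* ⟦ f ⟧ℚ
⟦ :- e   ⟧ℚ = ℚ.- ⟦ e ⟧ℚ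

ι-⟦⟧ : ∀ e → ι ⟦ e ⟧ℤ ≡ ⟦ e ⟧ℚ
ι-⟦⟧ (con i)  = refl
ι-⟦⟧ (e :+ f) = trans (ι-+ ⟦ e ⟧ℤ ⟦ f ⟧ℤ) (cong₂ ℚ._+_ (ι-⟦⟧ e) (ι-⟦⟧ f))
ι-⟦⟧ (e :* f) = trans (ι-* ⟦ e ⟧ℤ ⟦ f ⟧ℤ) (cong₂ ℚ._*_ (ι-⟦⟧ e) (ι-⟦⟧ f))
ι-⟦⟧ (:- e)   = trans (ι-neg ⟦ e ⟧ℤ) (cong ℚ.-_ (ι-⟦⟧ e))

*≡0⇒≡0 : ∀ {p q} → p ≢ 0ℚ → p ℚ.* q ≡ 0ℚ → q ≡ 0ℚ
*≡0⇒≡0 {p} {q} p≢0 pq≡0 = begin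
  q                    ≡⟨ sym (ℚ.*-identityˡ q) ⟩
  1ℚ ℚ.* q             ≡⟨ cong (ℚ._* q) (sym (ℚ.*-inverseˡ p)) ⟩
  ℚ.1/ p ℚ.* p ℚ.* q   ≡⟨ ℚ.*-assoc (ℚ.1/ p) p q ⟩
  ℚ.1/ p ℚ.* (p ℚ.* q) ≡⟨ cong (ℚ.1/ p ℚ.*_) pq≡0 ⟩
  ℚ.1/ p ℚ.* 0ℚ        ≡⟨ ℚ.*-zeroʳ (ℚ.1/ p) ⟩
  0ℚ                   ∎
  where
  open ≡-Reasoning
  instance _ = ℚ.≢-nonZero p≢0

record Clears (k : ℤ) (q : ℚ) : Set where
  constructor clears
  field
    numerator : ℤ
    scaled    : ι k ℚ.* q ≡ ι numerator

clears-↧ : ∀ q → Clears (↧ q) q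
clears-↧ q@(mkℚ n k _) = clears n (ℚ.toℚᵘ-injective (ℚᵘ.≃-trans (ℚ.toℚᵘ-homo-* (ι (↧ q)) q)
  (ℚᵘ.≃-trans (ℚᵘ.*-cong (toℚᵘ-ι (↧ q)) ℚᵘ.≃-refl) (ℚᵘ.≃-trans (*≡* cross) (ℚᵘ.≃-sym (toℚᵘ-ι n))))))
  where
  cross : + ℕ.suc k * n * + 1 ≡ n * + ℕ.suc (k ℕ.+ 0)
  cross = begin
    + ℕ.suc k * n * + 1 ≡⟨ comm (+ ℕ.suc k) ⟩
    n * + ℕ.suc k       ≡⟨ cong (λ j → n * + ℕ.suc j) (sym (ℕ.+-identityʳ k)) ⟩
    n * + ℕ.suc (k ℕ.+ 0) ∎
    where
    open ≡-Reasoning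
    comm : ∀ K → K * n * + 1 ≡ n * K
    comm K = solve (K ∷ n ∷ [])

clears-*ˡ : ∀ j {k q} → Clears k q → Clears (j * k) q
clears-*ˡ j {k} {q} (clears m kq≡m) = clears (j * m) (begin
  ι (j * k) ℚ.* q       ≡⟨ cong (ℚ._* q) (ι-* j k) ⟩
  ι j ℚ.* ι k ℚ.* q     ≡⟨ ℚ.*-assoc (ι j) (ι k) q ⟩
  ι j ℚ.* (ι k ℚ.* q)   ≡⟨ cong (ι j ℚ.*_) kq≡m ⟩
  ι j ℚ.* ι m           ≡⟨ sym (ι-* j m) ⟩
  ι (j * m)             ∎)
  where open ≡-Reasoning

clears-*ʳ : ∀ j {k q} → Clears k q → Clears (k * j) q
clears-*ʳ j {k} {q} cl = subst (λ k′ → Clears k′ q) (*-comm j k) (clears-*ˡ j cl)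

ClearsK : ℤ → QF → Set
ClearsK k x = Clears k (re x) × Clears k (im x)

clearsK-*ˡ : ∀ j {k x} → ClearsK k x → ClearsK (j * k) x
clearsK-*ˡ j (c₁ , c₂) = clears-*ˡ j c₁ , clears-*ˡ j c₂

clearsK-*ʳ : ∀ j {k x} → ClearsK k x → ClearsK (k * j) x
clearsK-*ʳ j (c₁ , c₂) = clears-*ʳ j c₁ , clears-*ʳ j c₂

den : QF → ℤ
den x = ↧ re x * ↧ im x

den≢0 : ∀ x → den x ≢ 0ℤ
den≢0 x = *-≢0 (↧≢0 (re x)) (↧≢0 (im x))
  where
  ↧≢0 : ∀ q → ↧ q ≢ 0ℤ
  ↧≢0 (mkℚ _ _ _) ()

clears-den : ∀ x → ClearsK (den x) x
clears-den x = clears-*ʳ (↧ im x) (clears-↧ (re x)) , clears-*ˡ (↧ re x) (clears-↧ (im x))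

common-denominator : ∀ x y z → ∃[ k ] (k ≢ 0ℤ) × ClearsK k x × ClearsK k y × ClearsK k z
common-denominator x y z =
  den x * den y * den z , *-≢0 (*-≢0 (den≢0 x) (den≢0 y)) (den≢0 z) ,
  clearsK-*ʳ (den z) (clearsK-*ʳ (den y) (clears-den x)) ,
  clearsK-*ʳ (den z) (clearsK-*ˡ (den x) (clears-den y)) ,
  clearsK-*ˡ (den x * den y) (clears-den z)

module QuadraticField (d : ℤ) where

  infixl 6 _+ₖ_
  infixl 7 _*ₖ_
  infixr 8 _⋆_ _^ₖ_

  _+ₖ_ : QF → QF → QF
  _+ₖ_ = addK d

  _*ₖ_ : QF → QF → QF
  _*ₖ_ = mulK d

  _^ₖ_ : QF → ℕ → QF
  _^ₖ_ = powK d

  _⋆_ : ℤ → QF → QF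
  k ⋆ x = (ι k ℚ.* re x) +√ (ι k ℚ.* im x)

  *ₖ-zeroˡ : ∀ x → 0K *ₖ x ≡ 0K
  *ₖ-zeroˡ x = cong₂ _+√_ (re-part (re x) (im x) (dℚ d)) (im-part (re x) (im x))
    where
    re-part : ∀ x₁ x₂ D → 0ℚ ℚ.* x₁ ℚ.+ D ℚ.* (0ℚ ℚ.* x₂) ≡ 0ℚ
    re-part = Ring.solve-∀ ℚ-ring
    im-part : ∀ x₁ x₂ → 0ℚ ℚ.* x₂ ℚ.+ 0ℚ ℚ.* x₁ ≡ 0ℚ
    im-part = Ring.solve-∀ ℚ-ring

  *ₖ-zeroʳ : ∀ x → x *ₖ 0K ≡ 0K
  *ₖ-zeroʳ x = cong₂ _+√_ (re-part (re x) (im x) (dℚ d)) (im-part (re x) (im x))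
    where
    re-part : ∀ x₁ x₂ D → x₁ ℚ.* 0ℚ ℚ.+ D ℚ.* (x₂ ℚ.* 0ℚ) ≡ 0ℚ
    re-part = Ring.solve-∀ ℚ-ring
    im-part : ∀ x₁ x₂ → x₁ ℚ.* 0ℚ ℚ.+ x₂ ℚ.* 0ℚ ≡ 0ℚ
    im-part = Ring.solve-∀ ℚ-ring

  *ₖ≢0⇒≢0ˡ : ∀ {x} y → x *ₖ y ≢ 0K → x ≢ 0K
  *ₖ≢0⇒≢0ˡ y xy≢0 refl = xy≢0 (*ₖ-zeroˡ y)

  *ₖ≢0⇒≢0ʳ : ∀ x {y} → x *ₖ y ≢ 0K → y ≢ 0K
  *ₖ≢0⇒≢0ʳ x xy≢0 refl = xy≢0 (*ₖ-zeroʳ x)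

  ⋆-*ₖˡ : ∀ k x y → (k ⋆ x) *ₖ y ≡ k ⋆ (x *ₖ y)
  ⋆-*ₖˡ k x y = cong₂ _+√_ (re-part (ι k) (re x) (im x) (re y) (im y) (dℚ d))
                           (im-part (ι k) (re x) (im x) (re y) (im y))
    where
    re-part : ∀ K x₁ x₂ y₁ y₂ D →
              K ℚ.* x₁ ℚ.* y₁ ℚ.+ D ℚ.* (K ℚ.* x₂ ℚ.* y₂) ≡ K ℚ.* (x₁ ℚ.* y₁ ℚ.+ D ℚ.* (x₂ ℚ.* y₂))
    re-part = Ring.solve-∀ ℚ-ring
    im-part : ∀ K x₁ x₂ y₁ y₂ →
              K ℚ.* x₁ ℚ.* y₂ ℚ.+ K ℚ.* x₂ ℚ.* y₁ ≡ K ℚ.* (x₁ ℚ.* y₂ ℚ.+ x₂ ℚ.* y₁)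
    im-part = Ring.solve-∀ ℚ-ring

  ⋆-*ₖʳ : ∀ k x y → x *ₖ (k ⋆ y) ≡ k ⋆ (x *ₖ y)
  ⋆-*ₖʳ k x y = cong₂ _+√_ (re-part (ι k) (re x) (im x) (re y) (im y) (dℚ d))
                           (im-part (ι k) (re x) (im x) (re y) (im y))
    where
    re-part : ∀ K x₁ x₂ y₁ y₂ D →
              x₁ ℚ.* (K ℚ.* y₁) ℚ.+ D ℚ.* (x₂ ℚ.* (K ℚ.* y₂)) ≡ K ℚ.* (x₁ ℚ.* y₁ ℚ.+ D ℚ.* (x₂ ℚ.* y₂))
    re-part = Ring.solve-∀ ℚ-ring
    im-part : ∀ K x₁ x₂ y₁ y₂ →
              x₁ ℚ.* (K ℚ.* y₂) ℚ.+ x₂ ℚ.* (K ℚ.* y₁) ≡ K ℚ.* (x₁ ℚ.* y₂ ℚ.+ x₂ ℚ.* y₁)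
    im-part = Ring.solve-∀ ℚ-ring

  ⋆-⋆ : ∀ j k x → j ⋆ k ⋆ x ≡ (j * k) ⋆ x
  ⋆-⋆ j k x = cong₂ _+√_ (assoc (re x)) (assoc (im x))
    where
    assoc : ∀ q → ι j ℚ.* (ι k ℚ.* q) ≡ ι (j * k) ℚ.* q
    assoc q = trans (sym (ℚ.*-assoc (ι j) (ι k) q)) (cong (ℚ._* q) (sym (ι-* j k)))

  ⋆-+ₖ : ∀ k x y → k ⋆ (x +ₖ y) ≡ k ⋆ x +ₖ k ⋆ y
  ⋆-+ₖ k x y = cong₂ _+√_ (ℚ.*-distribˡ-+ (ι k) (re x) (re y)) (ℚ.*-distribˡ-+ (ι k) (im x) (im y))

  ⋆-^ₖ : ∀ k x n → (k ⋆ x) ^ₖ n ≡ (k ^ n) ⋆ x ^ₖ n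
  ⋆-^ₖ k x ℕ.zero    = refl
  ⋆-^ₖ k x (ℕ.suc n) = begin
    (k ⋆ x) *ₖ (k ⋆ x) ^ₖ n          ≡⟨ cong ((k ⋆ x) *ₖ_) (⋆-^ₖ k x n) ⟩
    (k ⋆ x) *ₖ ((k ^ n) ⋆ x ^ₖ n)    ≡⟨ ⋆-*ₖˡ k x ((k ^ n) ⋆ x ^ₖ n) ⟩
    k ⋆ (x *ₖ ((k ^ n) ⋆ x ^ₖ n))    ≡⟨ cong (k ⋆_) (⋆-*ₖʳ (k ^ n) x (x ^ₖ n)) ⟩
    k ⋆ (k ^ n) ⋆ (x *ₖ x ^ₖ n)      ≡⟨ ⋆-⋆ k (k ^ n) (x *ₖ x ^ₖ n) ⟩
    (k * k ^ n) ⋆ (x *ₖ x ^ₖ n)      ∎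
    where open ≡-Reasoning

  ⋆-cancel : ∀ {k x} → k ≢ 0ℤ → k ⋆ x ≡ 0K → x ≡ 0K
  ⋆-cancel {k} {x} k≢0 kx≡0 = cong₂ _+√_ (*≡0⇒≡0 ιk≢0 (cong re kx≡0)) (*≡0⇒≡0 ιk≢0 (cong im kx≡0))
    where
    ιk≢0 : ι k ≢ 0ℚ
    ιk≢0 ιk≡0 = k≢0 (ι-injective ιk≡0)

  ⋆-Fermat : ∀ k x y z n → x ^ₖ n +ₖ y ^ₖ n ≡ z ^ₖ n → (k ⋆ x) ^ₖ n +ₖ (k ⋆ y) ^ₖ n ≡ (k ⋆ z) ^ₖ n
  ⋆-Fermat k x y z n eq = begin
    (k ⋆ x) ^ₖ n +ₖ (k ⋆ y) ^ₖ n          ≡⟨ cong₂ _+ₖ_ (⋆-^ₖ k x n) (⋆-^ₖ k y n) ⟩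
    (k ^ n) ⋆ x ^ₖ n +ₖ (k ^ n) ⋆ y ^ₖ n  ≡⟨ sym (⋆-+ₖ (k ^ n) (x ^ₖ n) (y ^ₖ n)) ⟩
    (k ^ n) ⋆ (x ^ₖ n +ₖ y ^ₖ n)          ≡⟨ cong ((k ^ n) ⋆_) eq ⟩
    (k ^ n) ⋆ z ^ₖ n                      ≡⟨ sym (⋆-^ₖ k z n) ⟩
    (k ⋆ z) ^ₖ n                          ∎
    where open ≡-Reasoning

  -- x₁ + x₂√d is a root of t² − 2x₁ t + (x₁² − d x₂²); re-part and im-part are the two
  -- components of IsAlgInt's sum for k = 2, unfolded. Here and below, subterms that are not
  -- polynomial in the variables enter as hypotheses; matching them with refl leaves a
  -- polynomial identity for the ring solver.
  isAlgInt-of-trace-norm : ∀ x (t m : ℤ) → ι t ≡ ℚ.- (re x ℚ.+ re x) →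
                           ι m ≡ re x ℚ.* re x ℚ.- dℚ d ℚ.* (im x ℚ.* im x) → IsAlgInt d x
  isAlgInt-of-trace-norm x t m t≡ m≡ =
    2 , coefficient ,
    cong₂ _+√_ (re-part (re x) (im x) (dℚ d) t≡ m≡) (im-part (re x) (im x) (dℚ d) t≡ m≡)
    where
    coefficient : Fin 2 → ℤ
    coefficient fzero        = m
    coefficient (fsuc fzero) = t
    re-part : ∀ {T M} x₁ x₂ D → T ≡ ℚ.- (x₁ ℚ.+ x₁) → M ≡ x₁ ℚ.* x₁ ℚ.- D ℚ.* (x₂ ℚ.* x₂) →
         x₁ ℚ.* (x₁ ℚ.* 1ℚ ℚ.+ D ℚ.* (x₂ ℚ.* 0ℚ)) ℚ.+ D ℚ.* (x₂ ℚ.* (x₁ ℚ.* 0ℚ ℚ.+ x₂ ℚ.* 1ℚ))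
         ℚ.+ (M ℚ.* 1ℚ ℚ.+ D ℚ.* (0ℚ ℚ.* 0ℚ)
              ℚ.+ (T ℚ.* (x₁ ℚ.* 1ℚ ℚ.+ D ℚ.* (x₂ ℚ.* 0ℚ)) ℚ.+ D ℚ.* (0ℚ ℚ.* (x₁ ℚ.* 0ℚ ℚ.+ x₂ ℚ.* 1ℚ))
                   ℚ.+ 0ℚ))
         ≡ 0ℚ
    re-part x₁ x₂ D refl refl = Ring.solve (x₁ ∷ x₂ ∷ D ∷ []) ℚ-ring
    im-part : ∀ {T M} x₁ x₂ D → T ≡ ℚ.- (x₁ ℚ.+ x₁) → M ≡ x₁ ℚ.* x₁ ℚ.- D ℚ.* (x₂ ℚ.* x₂) →
         x₁ ℚ.* (x₁ ℚ.* 0ℚ ℚ.+ x₂ ℚ.* 1ℚ) ℚ.+ x₂ ℚ.* (x₁ ℚ.* 1ℚ ℚ.+ D ℚ.* (x₂ ℚ.* 0ℚ))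
         ℚ.+ (M ℚ.* 0ℚ ℚ.+ 0ℚ ℚ.* 1ℚ
              ℚ.+ (T ℚ.* (x₁ ℚ.* 0ℚ ℚ.+ x₂ ℚ.* 1ℚ) ℚ.+ 0ℚ ℚ.* (x₁ ℚ.* 1ℚ ℚ.+ D ℚ.* (x₂ ℚ.* 0ℚ))
                   ℚ.+ 0ℚ))
         ≡ 0ℚ
    im-part x₁ x₂ D refl refl = Ring.solve (x₁ ∷ x₂ ∷ D ∷ []) ℚ-ring

module Centralizer (a b c : ℤ) where

  A : M2
  A = mat a b c 0ℤ

  -- (α , β) stands for α + βθ with θ² = aθ + bc; toM sends θ to A.
  ℤ[θ] : Set
  ℤ[θ] = ℤ × ℤ

  infixl 6 _⊕_
  infixl 7 _⊗_
  infixr 8 _^θ_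

  _⊕_ : ℤ[θ] → ℤ[θ] → ℤ[θ]
  (α , β) ⊕ (γ , δ) = α + γ , β + δ

  _⊗_ : ℤ[θ] → ℤ[θ] → ℤ[θ]
  (α , β) ⊗ (γ , δ) = α * γ + β * δ * (b * c) , α * δ + β * γ + β * δ * a

  𝟙 : ℤ[θ]
  𝟙 = 1ℤ , 0ℤ

  _^θ_ : ℤ[θ] → ℕ → ℤ[θ]
  p ^θ ℕ.zero  = 𝟙
  p ^θ ℕ.suc n = p ⊗ p ^θ n

  toM : ℤ[θ] → M2
  toM (α , β) = mat (α + β * a) (β * b) (β * c) α

  norm : ℤ[θ] → ℤ
  norm p = det (toM p)

  toM-⊕ : ∀ p q → toM (p ⊕ q) ≡ toM p ⊞ toM q
  toM-⊕ (α , β) (γ , δ) = mat-cong entry₁₁ (*-distribʳ-+ b β δ) (*-distribʳ-+ c β δ) refl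
    where
    entry₁₁ : α + γ + (β + δ) * a ≡ α + β * a + (γ + δ * a)
    entry₁₁ = solve (α ∷ β ∷ γ ∷ δ ∷ a ∷ [])

  toM-⊗ : ∀ p q → toM (p ⊗ q) ≡ toM p · toM q
  toM-⊗ (α , β) (γ , δ) = mat-cong entry₁₁ entry₁₂ entry₂₁ entry₂₂
    where
    entry₁₁ : α * γ + β * δ * (b * c) + (α * δ + β * γ + β * δ * a) * a
              ≡ (α + β * a) * (γ + δ * a) + β * b * (δ * c)
    entry₁₁ = solve (α ∷ β ∷ γ ∷ δ ∷ a ∷ b ∷ c ∷ [])
    entry₁₂ : (α * δ + β * γ + β * δ * a) * b ≡ (α + β * a) * (δ * b) + β * b * γ
    entry₁₂ = solve (α ∷ β ∷ γ ∷ δ ∷ a ∷ b ∷ [])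
    entry₂₁ : (α * δ + β * γ + β * δ * a) * c ≡ β * c * (γ + δ * a) + α * (δ * c)
    entry₂₁ = solve (α ∷ β ∷ γ ∷ δ ∷ a ∷ c ∷ [])
    entry₂₂ : α * γ + β * δ * (b * c) ≡ β * c * (δ * b) + α * γ
    entry₂₂ = solve (α ∷ β ∷ γ ∷ δ ∷ b ∷ c ∷ [])

  toM-^ : ∀ p n → toM (p ^θ n) ≡ toM p ^ᴹ n
  toM-^ p ℕ.zero    = refl
  toM-^ p (ℕ.suc n) = trans (toM-⊗ p (p ^θ n)) (cong (toM p ·_) (toM-^ p n))

  norm-⊗ : ∀ p q → norm (p ⊗ q) ≡ norm p * norm q
  norm-⊗ p q = trans (cong det (toM-⊗ p q)) (det-· (toM p) (toM q))

  toM-injective : b ≢ 0ℤ → ∀ p q → toM p ≡ toM q → p ≡ q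
  toM-injective b≢0 (α , β) (γ , δ) eq =
    cong₂ _,_ (cong m22 eq) (*-cancelʳ-≡ β δ b {{≢-nonZero b≢0}} (cong m12 eq))

  toM∈C : ∀ p → toM p ∈C A
  toM∈C (α , β) = mat-cong entry₁₁ entry₁₂ entry₂₁ entry₂₂
    where
    entry₁₁ : a * (α + β * a) + b * (β * c) ≡ (α + β * a) * a + β * b * c
    entry₁₁ = solve (α ∷ β ∷ a ∷ b ∷ c ∷ [])
    entry₁₂ : a * (β * b) + b * α ≡ (α + β * a) * b + β * b * 0ℤ
    entry₁₂ = solve (α ∷ β ∷ a ∷ b ∷ [])
    entry₂₁ : c * (α + β * a) + 0ℤ * (β * c) ≡ β * c * a + α * c
    entry₂₁ = solve (α ∷ β ∷ a ∷ c ∷ [])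
    entry₂₂ : c * (β * b) + 0ℤ * α ≡ β * c * b + α * 0ℤ
    entry₂₂ = solve (α ∷ β ∷ b ∷ c ∷ [])

  ∈C⇒∈image : b ≢ 0ℤ → gcd (gcd a b) c ≡ + 1 → ∀ X → X ∈C A → ∃[ p ] toM p ≡ X
  ∈C⇒∈image b≢0 gcd≡1 (mat p q s t) AX≡XA =
    preimage (gcd≡1∧∣*⇒∣ a b c gcd≡1
      (divides (p - t) aq≡[p-t]b) (divides q (*-comm b q)) (divides s cq≡sb))
    where
    open ≡-Reasoning
    instance _ = ≢-nonZero b≢0
    aq≡[p-t]b : a * q ≡ (p - t) * b
    aq≡[p-t]b = begin
      a * q                       ≡⟨ solve (a ∷ q ∷ b ∷ t ∷ []) ⟩
      (a * q + b * t) - b * t     ≡⟨ cong (_- b * t) (cong m12 AX≡XA) ⟩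
      (p * b + q * 0ℤ) - b * t    ≡⟨ solve (p ∷ q ∷ b ∷ t ∷ []) ⟩
      (p - t) * b                 ∎
    cq≡sb : c * q ≡ s * b
    cq≡sb = begin
      c * q                       ≡⟨ solve (c ∷ q ∷ p ∷ a ∷ []) ⟩
      (p * a + q * c) - a * p     ≡⟨ cong (_- a * p) (sym (cong m11 AX≡XA)) ⟩
      (a * p + b * s) - a * p     ≡⟨ solve (a ∷ p ∷ b ∷ s ∷ []) ⟩
      s * b                       ∎
    preimage : b ∣ q → ∃[ p′ ] toM p′ ≡ mat p q s t
    preimage (divides β q≡βb) = (t , β) , mat-cong (sym p≡t+βa) (sym q≡βb) (sym s≡βc) refl
      where
      xq≡βxb : ∀ x → x * q ≡ β * x * b
      xq≡βxb x = trans (cong (x *_) q≡βb) (solve (x ∷ β ∷ b ∷ []))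
      s≡βc : s ≡ β * c
      s≡βc = *-cancelʳ-≡ s (β * c) b (trans (sym cq≡sb) (xq≡βxb c))
      p≡t+βa : p ≡ t + β * a
      p≡t+βa = begin
        p             ≡⟨ solve (p ∷ t ∷ []) ⟩
        t + (p - t)   ≡⟨ cong (λ u → t + u)
                           (*-cancelʳ-≡ (p - t) (β * a) b (trans (sym aq≡[p-t]b) (xq≡βxb a))) ⟩
        t + β * a     ∎

  toM-sum-of-powers : ∀ p q n → toM (p ^θ n ⊕ q ^θ n) ≡ (toM p ^ᴹ n) ⊞ (toM q ^ᴹ n)
  toM-sum-of-powers p q n = trans (toM-⊕ (p ^θ n) (q ^θ n)) (cong₂ _⊞_ (toM-^ p n) (toM-^ q n))

  Fermatθ : ℕ → Set
  Fermatθ n = ∃[ p ] ∃[ q ] ∃[ s ]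
    (norm p ≢ 0ℤ) × (norm q ≢ 0ℤ) × (norm s ≢ 0ℤ) × (p ^θ n ⊕ q ^θ n ≡ s ^θ n)

  FermatC⇔Fermatθ : b ≢ 0ℤ → gcd (gcd a b) c ≡ + 1 → ∀ n → FermatC A n ⇔ Fermatθ n
  FermatC⇔Fermatθ b≢0 gcd≡1 n = mk⇔ to from
    where
    to : FermatC A n → Fermatθ n
    to (X , Y , Z , X∈C , Y∈C , Z∈C , det≢0 , eq) =
      descend (∈C⇒∈image b≢0 gcd≡1 X X∈C) (∈C⇒∈image b≢0 gcd≡1 Y Y∈C) (∈C⇒∈image b≢0 gcd≡1 Z Z∈C)
              det≢0 eq
      where
      descend : ∀ {X Y Z} → ∃[ p ] toM p ≡ X → ∃[ q ] toM q ≡ Y → ∃[ s ] toM s ≡ Z →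
                det (X · (Y · Z)) ≢ 0ℤ → (X ^ᴹ n) ⊞ (Y ^ᴹ n) ≡ Z ^ᴹ n → Fermatθ n
      descend (p , refl) (q , refl) (s , refl) det≢0 eq =
        p , q , s , *≢0⇒≢0ˡ (norm q * norm s) N≢0 , *≢0⇒≢0ˡ (norm s) (*≢0⇒≢0ʳ (norm p) N≢0) ,
        *≢0⇒≢0ʳ (norm q) (*≢0⇒≢0ʳ (norm p) N≢0) ,
        toM-injective b≢0 (p ^θ n ⊕ q ^θ n) (s ^θ n)
          (trans (toM-sum-of-powers p q n) (trans eq (sym (toM-^ s n))))
        where
        N≢0 : norm p * (norm q * norm s) ≢ 0ℤ
        N≢0 = subst (_≢ 0ℤ) (det-·³ (toM p) (toM q) (toM s)) det≢0
    from : Fermatθ n → FermatC A n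
    from (p , q , s , Np≢0 , Nq≢0 , Ns≢0 , eq) =
      toM p , toM q , toM s , toM∈C p , toM∈C q , toM∈C s ,
      subst (_≢ 0ℤ) (sym (det-·³ (toM p) (toM q) (toM s))) (*-≢0 Np≢0 (*-≢0 Nq≢0 Ns≢0)) ,
      trans (sym (toM-sum-of-powers p q n)) (trans (cong toM eq) (toM-^ s n))

  const : ℤ → ℤ[θ]
  const x = x , 0ℤ

  const-⊗ : ∀ x y → const x ⊗ const y ≡ const (x * y)
  const-⊗ x y = cong₂ _,_ first second
    where
    first : x * y + 0ℤ * 0ℤ * (b * c) ≡ x * y
    first = solve (x ∷ y ∷ b ∷ c ∷ [])
    second : x * 0ℤ + 0ℤ * y + 0ℤ * 0ℤ * a ≡ 0ℤ
    second = solve (x ∷ y ∷ a ∷ [])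

  const-^ : ∀ x n → const x ^θ n ≡ const (x ^ n)
  const-^ x ℕ.zero    = refl
  const-^ x (ℕ.suc n) = trans (cong (const x ⊗_) (const-^ x n)) (const-⊗ x (x ^ n))

  norm-const : ∀ x → norm (const x) ≡ x * x
  norm-const x = identity
    where
    identity : (x + 0ℤ * a) * x - 0ℤ * b * (0ℤ * c) ≡ x * x
    identity = solve (x ∷ a ∷ b ∷ c ∷ [])

  module Root (τ : ℤ) (τ-root : τ * τ ≡ a * τ + b * c) where

    ev : ℤ[θ] → ℤ
    ev (α , β) = α + β * τ

    ev-⊕ : ∀ p q → ev (p ⊕ q) ≡ ev p + ev q
    ev-⊕ (α , β) (γ , δ) = identity
      where
      identity : α + γ + (β + δ) * τ ≡ α + β * τ + (γ + δ * τ)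
      identity = solve (α ∷ β ∷ γ ∷ δ ∷ τ ∷ [])

    ev-⊗ : ∀ p q → ev (p ⊗ q) ≡ ev p * ev q
    ev-⊗ (α , β) (γ , δ) = begin
      α * γ + β * δ * (b * c) + (α * δ + β * γ + β * δ * a) * τ
        ≡⟨ solve (α ∷ β ∷ γ ∷ δ ∷ a ∷ b ∷ c ∷ τ ∷ []) ⟩
      α * γ + (α * δ + β * γ) * τ + β * δ * (a * τ + b * c)
        ≡⟨ cong (λ u → α * γ + (α * δ + β * γ) * τ + β * δ * u) (sym τ-root) ⟩
      α * γ + (α * δ + β * γ) * τ + β * δ * (τ * τ)
        ≡⟨ solve (α ∷ β ∷ γ ∷ δ ∷ τ ∷ []) ⟩
      (α + β * τ) * (γ + δ * τ) ∎
      where open ≡-Reasoning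

    ev-^ : ∀ p n → ev (p ^θ n) ≡ ev p ^ n
    ev-^ p ℕ.zero    = identity
      where
      identity : 1ℤ + 0ℤ * τ ≡ 1ℤ
      identity = solve (τ ∷ [])
    ev-^ p (ℕ.suc n) = trans (ev-⊗ p (p ^θ n)) (cong (ev p *_) (ev-^ p n))

    ev-sum-of-powers : ∀ p q n → ev (p ^θ n ⊕ q ^θ n) ≡ ev p ^ n + ev q ^ n
    ev-sum-of-powers p q n = trans (ev-⊕ (p ^θ n) (q ^θ n)) (cong₂ _+_ (ev-^ p n) (ev-^ q n))

    norm≡ev*ev′ : ∀ α β → norm (α , β) ≡ ev (α , β) * (α + β * (a - τ))
    norm≡ev*ev′ α β = begin
      (α + β * a) * α - β * b * (β * c)
        ≡⟨ solve (α ∷ β ∷ a ∷ b ∷ c ∷ τ ∷ []) ⟩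
      (α + β * a) * α + β * β * (a * τ) - β * β * (a * τ + b * c)
        ≡⟨ cong (λ u → (α + β * a) * α + β * β * (a * τ) - β * β * u) (sym τ-root) ⟩
      (α + β * a) * α + β * β * (a * τ) - β * β * (τ * τ)
        ≡⟨ solve (α ∷ β ∷ a ∷ τ ∷ []) ⟩
      (α + β * τ) * (α + β * (a - τ)) ∎
      where open ≡-Reasoning

    Fermatθ⇔Fermatℤ : ∀ n → Fermatθ n ⇔ Fermatℤ n
    Fermatθ⇔Fermatℤ n = mk⇔ to from
      where
      ev≢0 : ∀ p → norm p ≢ 0ℤ → ev p ≢ 0ℤ
      ev≢0 (α , β) Np≢0 = *≢0⇒≢0ˡ (α + β * (a - τ)) (subst (_≢ 0ℤ) (norm≡ev*ev′ α β) Np≢0)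
      to : Fermatθ n → Fermatℤ n
      to (p , q , s , Np≢0 , Nq≢0 , Ns≢0 , eq) =
        ev p , ev q , ev s , *-≢0 (*-≢0 (ev≢0 p Np≢0) (ev≢0 q Nq≢0)) (ev≢0 s Ns≢0) ,
        trans (sym (ev-sum-of-powers p q n)) (trans (cong ev eq) (ev-^ s n))
      from : Fermatℤ n → Fermatθ n
      from (x , y , z , xyz≢0 , eq) =
        const x , const y , const z ,
        N≢0 x (*≢0⇒≢0ˡ y (*≢0⇒≢0ˡ z xyz≢0)) , N≢0 y (*≢0⇒≢0ʳ x (*≢0⇒≢0ˡ z xyz≢0)) ,
        N≢0 z (*≢0⇒≢0ʳ (x * y) xyz≢0) ,
        trans (cong₂ _⊕_ (const-^ x n) (const-^ y n)) (trans (cong const eq) (sym (const-^ z n)))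
        where
        N≢0 : ∀ w → w ≢ 0ℤ → norm (const w) ≢ 0ℤ
        N≢0 w w≢0 = subst (_≢ 0ℤ) (sym (norm-const w)) (*-≢0 w≢0 w≢0)

  disc : ℤ
  disc = a * a + + 4 * b * c

  norm≡0⇒square-disc : ∀ α β → β ≢ 0ℤ → norm (α , β) ≡ 0ℤ → IsSquare disc
  norm≡0⇒square-disc α β β≢0 N≡0 = m²≡Dβ²⇒IsSquare (α + α + β * a) β disc β≢0 (begin
    (α + α + β * a) * (α + α + β * a)
      ≡⟨ solve (α ∷ β ∷ a ∷ b ∷ c ∷ []) ⟩
    (a * a + + 4 * b * c) * (β * β) + + 4 * ((α + β * a) * α - β * b * (β * c))
      ≡⟨ cong (λ N → (a * a + + 4 * b * c) * (β * β) + + 4 * N) N≡0 ⟩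
    (a * a + + 4 * b * c) * (β * β) + + 4 * 0ℤ
      ≡⟨ solve (a ∷ b ∷ c ∷ β ∷ []) ⟩
    (a * a + + 4 * b * c) * (β * β) ∎)
    where open ≡-Reasoning

  norm≡0⇒≡0 : ¬ IsSquare disc → ∀ p → norm p ≡ 0ℤ → p ≡ (0ℤ , 0ℤ)
  norm≡0⇒≡0 ¬square (α , +0) N≡0 =
    cong (_, 0ℤ) ([ id , id ]′ (i*j≡0⇒i≡0∨j≡0 α (trans (sym (norm-const α)) N≡0)))
  norm≡0⇒≡0 ¬square (α , +[1+ j ]) N≡0 = ⊥-elim (¬square (norm≡0⇒square-disc α +[1+ j ] (λ ()) N≡0))
  norm≡0⇒≡0 ¬square (α , -[1+ j ]) N≡0 = ⊥-elim (¬square (norm≡0⇒square-disc α -[1+ j ] (λ ()) N≡0))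

  module Embedding where
    open QuadraticField disc

    φ : ℤ[θ] → QF
    φ (α , β) = (ι α ℚ.+ ι β ℚ.* ι a ℚ.* ½) +√ (ι β ℚ.* ½)

    ι-disc : dℚ disc ≡ ι a ℚ.* ι a ℚ.+ ι (+ 4) ℚ.* ι b ℚ.* ι c
    ι-disc = ι-⟦⟧ (con a :* con a :+ con (+ 4) :* con b :* con c)

    φ-⊕ : ∀ p q → φ (p ⊕ q) ≡ φ p +ₖ φ q
    φ-⊕ (α , β) (γ , δ) =
      cong₂ _+√_ (re-part (ι α) (ι β) (ι γ) (ι δ) (ι a) (ι-+ α γ) (ι-+ β δ))
                 (im-part (ι β) (ι δ) (ι-+ β δ))
      where
      re-part : ∀ {X Y} α β γ δ A → X ≡ α ℚ.+ γ → Y ≡ β ℚ.+ δ →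
           X ℚ.+ Y ℚ.* A ℚ.* ½ ≡ α ℚ.+ β ℚ.* A ℚ.* ½ ℚ.+ (γ ℚ.+ δ ℚ.* A ℚ.* ½)
      re-part α β γ δ A refl refl = Ring.solve (α ∷ β ∷ γ ∷ δ ∷ A ∷ []) ℚ-ring
      im-part : ∀ {Y} β δ → Y ≡ β ℚ.+ δ → Y ℚ.* ½ ≡ β ℚ.* ½ ℚ.+ δ ℚ.* ½
      im-part β δ refl = Ring.solve (β ∷ δ ∷ []) ℚ-ring

    φ-⊗ : ∀ p q → φ (p ⊗ q) ≡ φ p *ₖ φ q
    φ-⊗ (α , β) (γ , δ) = cong₂ _+√_
      (re-part (ι α) (ι β) (ι γ) (ι δ) (ι a) (ι b) (ι c)
        (ι-⟦⟧ constant-term) (ι-⟦⟧ θ-coefficient) ι-disc)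
      (im-part (ι α) (ι β) (ι γ) (ι δ) (ι a) (ι-⟦⟧ θ-coefficient))
      where
      constant-term θ-coefficient : Expr
      constant-term = con α :* con γ :+ con β :* con δ :* (con b :* con c)
      θ-coefficient = con α :* con δ :+ con β :* con γ :+ con β :* con δ :* con a
      re-part : ∀ {X Y D} α β γ δ A B C → X ≡ α ℚ.* γ ℚ.+ β ℚ.* δ ℚ.* (B ℚ.* C) →
           Y ≡ α ℚ.* δ ℚ.+ β ℚ.* γ ℚ.+ β ℚ.* δ ℚ.* A → D ≡ A ℚ.* A ℚ.+ ι (+ 4) ℚ.* B ℚ.* C →
           X ℚ.+ Y ℚ.* A ℚ.* ½
             ≡ (α ℚ.+ β ℚ.* A ℚ.* ½) ℚ.* (γ ℚ.+ δ ℚ.* A ℚ.* ½) ℚ.+ D ℚ.* (β ℚ.* ½ ℚ.* (δ ℚ.* ½))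
      re-part α β γ δ A B C refl refl refl = Ring.solve (α ∷ β ∷ γ ∷ δ ∷ A ∷ B ∷ C ∷ []) ℚ-ring
      im-part : ∀ {Y} α β γ δ A → Y ≡ α ℚ.* δ ℚ.+ β ℚ.* γ ℚ.+ β ℚ.* δ ℚ.* A →
           Y ℚ.* ½ ≡ (α ℚ.+ β ℚ.* A ℚ.* ½) ℚ.* (δ ℚ.* ½) ℚ.+ β ℚ.* ½ ℚ.* (γ ℚ.+ δ ℚ.* A ℚ.* ½)
      im-part α β γ δ A refl = Ring.solve (α ∷ β ∷ γ ∷ δ ∷ A ∷ []) ℚ-ring

    φ-^ : ∀ p n → φ (p ^θ n) ≡ φ p ^ₖ n
    φ-^ p ℕ.zero    = cong₂ _+√_ (identity (ι a)) refl
      where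
      identity : ∀ A → 1ℚ ℚ.+ 0ℚ ℚ.* A ℚ.* ½ ≡ 1ℚ
      identity = Ring.solve-∀ ℚ-ring
    φ-^ p (ℕ.suc n) = trans (φ-⊗ p (p ^θ n)) (cong (φ p *ₖ_) (φ-^ p n))

    φ-sum-of-powers : ∀ p q n → φ (p ^θ n ⊕ q ^θ n) ≡ φ p ^ₖ n +ₖ φ q ^ₖ n
    φ-sum-of-powers p q n = trans (φ-⊕ (p ^θ n) (q ^θ n)) (cong₂ _+ₖ_ (φ-^ p n) (φ-^ q n))

    φ-zero : φ (0ℤ , 0ℤ) ≡ 0K
    φ-zero = cong₂ _+√_ (identity (ι a)) refl
      where
      identity : ∀ A → 0ℚ ℚ.+ 0ℚ ℚ.* A ℚ.* ½ ≡ 0ℚ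
      identity = Ring.solve-∀ ℚ-ring

    ψ : QF → ℚ × ℚ
    ψ x = re x ℚ.- im x ℚ.* ι a , im x ℚ.+ im x

    ψ∘φ : ∀ α β → ψ (φ (α , β)) ≡ (ι α , ι β)
    ψ∘φ α β = cong₂ _,_ (re-part (ι α) (ι β) (ι a)) (im-part (ι β))
      where
      re-part : ∀ α β A → α ℚ.+ β ℚ.* A ℚ.* ½ ℚ.- β ℚ.* ½ ℚ.* A ≡ α
      re-part = Ring.solve-∀ ℚ-ring
      im-part : ∀ β → β ℚ.* ½ ℚ.+ β ℚ.* ½ ≡ β
      im-part = Ring.solve-∀ ℚ-ring

    φ-injective : ∀ p q → φ p ≡ φ q → p ≡ q
    φ-injective (α , β) (γ , δ) φp≡φq =
      cong₂ _,_ (ι-injective (cong proj₁ ψ-eq)) (ι-injective (cong proj₂ ψ-eq))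
      where
      ψ-eq : (ι α , ι β) ≡ (ι γ , ι δ)
      ψ-eq = trans (sym (ψ∘φ α β)) (trans (cong ψ φp≡φq) (ψ∘φ γ δ))

    φ-ℤ[√d] : ∀ m₁ m₂ → φ (m₁ - m₂ * a , m₂ + m₂) ≡ ι m₁ +√ ι m₂
    φ-ℤ[√d] m₁ m₂ = cong₂ _+√_
      (re-part (ι m₁) (ι m₂) (ι a) (ι-⟦⟧ (con m₁ :+ :- (con m₂ :* con a))) (ι-+ m₂ m₂))
      (im-part (ι m₂) (ι-+ m₂ m₂))
      where
      re-part : ∀ {X Y} M₁ M₂ A → X ≡ M₁ ℚ.+ ℚ.- (M₂ ℚ.* A) → Y ≡ M₂ ℚ.+ M₂ →
                X ℚ.+ Y ℚ.* A ℚ.* ½ ≡ M₁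
      re-part M₁ M₂ A refl refl = Ring.solve (M₁ ∷ M₂ ∷ A ∷ []) ℚ-ring
      im-part : ∀ {Y} M₂ → Y ≡ M₂ ℚ.+ M₂ → Y ℚ.* ½ ≡ M₂
      im-part M₂ refl = Ring.solve (M₂ ∷ []) ℚ-ring

    φ-preimage : ∀ {k x} → ClearsK k x → ∃[ p ] φ p ≡ k ⋆ x
    φ-preimage (clears m₁ kx₁≡m₁ , clears m₂ kx₂≡m₂) =
      (m₁ - m₂ * a , m₂ + m₂) , trans (φ-ℤ[√d] m₁ m₂) (cong₂ _+√_ (sym kx₁≡m₁) (sym kx₂≡m₂))

    φ-isAlgInt : ∀ p → IsAlgInt disc (φ p)
    φ-isAlgInt (α , β) = isAlgInt-of-trace-norm (φ (α , β)) (- (α + α + β * a)) (norm (α , β))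
      (trace-identity (ι α) (ι β) (ι a) (ι-⟦⟧ (:- (con α :+ con α :+ con β :* con a))))
      (norm-identity (ι α) (ι β) (ι a) (ι b) (ι c)
        (ι-⟦⟧ ((con α :+ con β :* con a) :* con α :+ :- (con β :* con b :* (con β :* con c))))
        ι-disc)
      where
      trace-identity : ∀ {T} α β A → T ≡ ℚ.- (α ℚ.+ α ℚ.+ β ℚ.* A) →
           T ≡ ℚ.- (α ℚ.+ β ℚ.* A ℚ.* ½ ℚ.+ (α ℚ.+ β ℚ.* A ℚ.* ½))
      trace-identity α β A refl = Ring.solve (α ∷ β ∷ A ∷ []) ℚ-ring
      norm-identity : ∀ {N D} α β A B C →
           N ≡ (α ℚ.+ β ℚ.* A) ℚ.* α ℚ.+ ℚ.- (β ℚ.* B ℚ.* (β ℚ.* C)) →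
           D ≡ A ℚ.* A ℚ.+ ι (+ 4) ℚ.* B ℚ.* C →
           N ≡ (α ℚ.+ β ℚ.* A ℚ.* ½) ℚ.* (α ℚ.+ β ℚ.* A ℚ.* ½) ℚ.- D ℚ.* (β ℚ.* ½ ℚ.* (β ℚ.* ½))
      norm-identity α β A B C refl refl = Ring.solve (α ∷ β ∷ A ∷ B ∷ C ∷ []) ℚ-ring

    φ-⊗³ : ∀ p q s → φ (p ⊗ (q ⊗ s)) ≡ φ p *ₖ (φ q *ₖ φ s)
    φ-⊗³ p q s = trans (φ-⊗ p (q ⊗ s)) (cong (φ p *ₖ_) (φ-⊗ q s))

    norm≢0⇒φ≢0 : ∀ t → norm t ≢ 0ℤ → φ t ≢ 0K
    norm≢0⇒φ≢0 t Nt≢0 φt≡0 =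
      Nt≢0 (trans (cong norm (φ-injective t (0ℤ , 0ℤ) (trans φt≡0 (sym φ-zero)))) (norm-const 0ℤ))

    Fermatθ⇒FermatOK : ∀ n → Fermatθ n → FermatOK disc n
    Fermatθ⇒FermatOK n (p , q , s , Np≢0 , Nq≢0 , Ns≢0 , eq) =
      φ p , φ q , φ s , φ-isAlgInt p , φ-isAlgInt q , φ-isAlgInt s ,
      subst (_≢ 0K) (φ-⊗³ p q s) (norm≢0⇒φ≢0 (p ⊗ (q ⊗ s)) Npqs≢0) ,
      trans (sym (φ-sum-of-powers p q n)) (trans (cong φ eq) (φ-^ s n))
      where
      Npqs≢0 : norm (p ⊗ (q ⊗ s)) ≢ 0ℤ
      Npqs≢0 = subst (_≢ 0ℤ) (sym (trans (norm-⊗ p (q ⊗ s)) (cong (norm p *_) (norm-⊗ q s))))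
                 (*-≢0 Np≢0 (*-≢0 Nq≢0 Ns≢0))

    FermatOK⇒Fermatθ : ¬ IsSquare disc → ∀ n → FermatOK disc n → Fermatθ n
    FermatOK⇒Fermatθ ¬square n (x , y , z , _ , _ , _ , xyz≢0 , eq) = descend (common-denominator x y z)
      where
      x≢0 : x ≢ 0K
      x≢0 = *ₖ≢0⇒≢0ˡ (y *ₖ z) xyz≢0
      y≢0 : y ≢ 0K
      y≢0 = *ₖ≢0⇒≢0ˡ z (*ₖ≢0⇒≢0ʳ x xyz≢0)
      z≢0 : z ≢ 0K
      z≢0 = *ₖ≢0⇒≢0ʳ y (*ₖ≢0⇒≢0ʳ x xyz≢0)
      descend : ∃[ k ] (k ≢ 0ℤ) × ClearsK k x × ClearsK k y × ClearsK k z → Fermatθ n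
      descend (k , k≢0 , x-cleared , y-cleared , z-cleared) =
        lift (φ-preimage x-cleared) (φ-preimage y-cleared) (φ-preimage z-cleared)
        where
        norm≢0 : ∀ p {w} → φ p ≡ k ⋆ w → w ≢ 0K → norm p ≢ 0ℤ
        norm≢0 p φp≡kw w≢0 Np≡0 =
          w≢0 (⋆-cancel k≢0 (trans (sym φp≡kw) (trans (cong φ (norm≡0⇒≡0 ¬square p Np≡0)) φ-zero)))
        lift : ∃[ p ] φ p ≡ k ⋆ x → ∃[ q ] φ q ≡ k ⋆ y → ∃[ s ] φ s ≡ k ⋆ z → Fermatθ n
        lift (p , φp≡kx) (q , φq≡ky) (s , φs≡kz) =
          p , q , s , norm≢0 p φp≡kx x≢0 , norm≢0 q φq≡ky y≢0 , norm≢0 s φs≡kz z≢0 ,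
          φ-injective (p ^θ n ⊕ q ^θ n) (s ^θ n) (begin
            φ (p ^θ n ⊕ q ^θ n)            ≡⟨ φ-sum-of-powers p q n ⟩
            φ p ^ₖ n +ₖ φ q ^ₖ n           ≡⟨ cong₂ (λ u v → u ^ₖ n +ₖ v ^ₖ n) φp≡kx φq≡ky ⟩
            (k ⋆ x) ^ₖ n +ₖ (k ⋆ y) ^ₖ n   ≡⟨ ⋆-Fermat k x y z n eq ⟩
            (k ⋆ z) ^ₖ n                   ≡⟨ cong (_^ₖ n) (sym φs≡kz) ⟩
            φ s ^ₖ n                       ≡⟨ sym (φ-^ s n) ⟩
            φ (s ^θ n)                     ∎)
          where open ≡-Reasoning

corollary3p5 : (a b c : ℤ) → (b * c) ≢ + 0 → gcd (gcd a b) c ≡ + 1 → (n : ℕ) → n ≥ 3 →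
    (IsSquare (a * a + + 4 * b * c) → (FermatC (mat a b c (+ 0)) n ⇔ Fermatℤ n))
    × (¬ IsSquare (a * a + + 4 * b * c) → (FermatC (mat a b c (+ 0)) n ⇔ FermatOK (a * a + + 4 * b * c) n))
corollary3p5 a b c bc≢0 gcd≡1 n _ = square-case , non-square-case
  where
  open Centralizer a b c
  C⇔θ : FermatC A n ⇔ Fermatθ n
  C⇔θ = FermatC⇔Fermatθ (*≢0⇒≢0ˡ c bc≢0) gcd≡1 n
  square-case : IsSquare disc → FermatC A n ⇔ Fermatℤ n
  square-case (r , r²≡disc) =
    let τ , τ-root = square-discriminant⇒root a b c r r²≡disc
    in ⇔.trans C⇔θ (Root.Fermatθ⇔Fermatℤ τ τ-root n)
  non-square-case : ¬ IsSquare disc → FermatC A n ⇔ FermatOK disc n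
  non-square-case ¬square =
    ⇔.trans C⇔θ (mk⇔ (Embedding.Fermatθ⇒FermatOK n) (Embedding.FermatOK⇒Fermatθ ¬square n))
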